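{- Let $\Gamma$ be a temporal constraint language preserved by an operation $h \in \{ \min, \mathrm{mx} \}$. Let $\Phi(z_1, \ldots, z_m) = \forall y \exists x_1 \ldots \exists x_n \phi$ be a quantified constraint formula over $\Gamma$ having free variables $\{ z_1, \ldots, z_m \}$. Let $\Phi'(z_1, \ldots, z_m)$ be the formula $\exists y \exists x_1 \ldots \exists x_n (\phi \wedge \bigwedge_{i \in [m]} (z_i < y))$. If the formula $\Phi$ is satisfiable, then the formulas $\Phi$, $\Phi'$ have the same satisfying assignments over $\Gamma$.
   Context: A temporal constraint language is a structure with domain $\mathbb{Q}$ whose relations are first-order definable over $(\mathbb{Q};<)$. A quantified constraint formula over $\Gamma$ is a formula $Q_1 v_1\dots Q_n v_n(\psi_1\wedge\dots\wedge\psi_m)$ with $Q_i\in\{\exists,\forall\}$ and each $\psi_i$ an atomic formula $R(y_1,\dots,y_k)$ for a relation symbol $R$ of $\Gamma$. The binary operation $\mathrm{mx}$ on $\mathbb{Q}$ is defined by $\mathrm{mx}(x,y)=\alpha(\min(x,y))$ if $x\neq y$ and $\mathrm{mx}(x,y)=\beta(x)$ if $x=y$, where $\alpha,\beta$ are unary operations preserving $<$ such that $\alpha(x)<\beta(x)<\alpha(x+\varepsilon)$ for all $x\in\mathbb{Q}$ and all rational $\varepsilon>0$. An operation preserves $\Gamma$ if applying it componentwise to tuples of each relation yields a tuple of that relation. -}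

module Defs where

open import Data.Nat using (ℕ; suc)
open import Data.Fin using (Fin; zero; suc)
open import Data.Rational using (ℚ; _<_; _+_; _⊓_; 0ℚ)
open import Data.Rational.Properties using (_≟_)
open import Data.Product using (Σ; _×_; _,_)
open import Data.Sum using (_⊎_)
open import Data.List using (List)
open import Data.List.Relation.Unary.All using (All)
open import Data.Unit using (⊤)
open import Data.Empty using (⊥)
open import Relation.Nullary using (¬_; yes; no)
open import Relation.Binary.PropositionalEquality using (_≡_)
open import Function.Bundles using (_⇔_)

data FO : ℕ → Set where
  ⊤ᶠ  : ∀ {k} → FO k
  ltᶠ : ∀ {k} → Fin k → Fin k → FO k
  eqᶠ : ∀ {k} → Fin k → Fin k → FO k
  ¬ᶠ  : ∀ {k} → FO k → FO k
  _∧ᶠ_ : ∀ {k} → FO k → FO k → FO k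
  ∃ᶠ  : ∀ {k} → FO (suc k) → FO k

extend : ∀ {k} → ℚ → (Fin k → ℚ) → (Fin (suc k) → ℚ)
extend a t zero    = a
extend a t (suc i) = t i

⟦_⟧ : ∀ {k} → FO k → (Fin k → ℚ) → Set
⟦ ⊤ᶠ ⟧      t = ⊤
⟦ ltᶠ i j ⟧ t = t i < t j
⟦ eqᶠ i j ⟧ t = t i ≡ t j
⟦ ¬ᶠ φ ⟧    t = ¬ ⟦ φ ⟧ t
⟦ φ ∧ᶠ ψ ⟧  t = ⟦ φ ⟧ t × ⟦ ψ ⟧ t
⟦ ∃ᶠ φ ⟧    t = Σ ℚ λ a → ⟦ φ ⟧ (extend a t)

record TemporalLanguage : Set₁ where
  field
    Sym      : Set
    arity    : Sym → ℕ
    rel      : (R : Sym) → (Fin (arity R) → ℚ) → Set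
    definable : (R : Sym) → Σ (FO (arity R)) λ ψ →
                  ∀ t → rel R t ⇔ ⟦ ψ ⟧ t

open TemporalLanguage public

Preserves : (ℚ → ℚ → ℚ) → TemporalLanguage → Set
Preserves h Γ = ∀ (R : Sym Γ) (t s : Fin (arity Γ R) → ℚ) →
  rel Γ R t → rel Γ R s → rel Γ R (λ i → h (t i) (s i))

IsMxPair : (ℚ → ℚ) → (ℚ → ℚ) → Set
IsMxPair α β =
  (∀ x y → x < y → α x < α y) ×
  (∀ x y → x < y → β x < β y) ×
  (∀ x → α x < β x) ×
  (∀ x ε → 0ℚ < ε → β x < α (x + ε))

mx : (ℚ → ℚ) → (ℚ → ℚ) → ℚ → ℚ → ℚ
mx α β x y with x ≟ y
... | yes _ = β x
... | no  _ = α (x ⊓ y)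

IsMinOrMx : (ℚ → ℚ → ℚ) → Set
IsMinOrMx h =
  (∀ x y → h x y ≡ x ⊓ y) ⊎
  Σ (ℚ → ℚ) λ α → Σ (ℚ → ℚ) λ β →
    IsMxPair α β × (∀ x y → h x y ≡ mx α β x y)

data Var (m n : ℕ) : Set where
  zv : Fin m → Var m n
  yv : Var m n
  xv : Fin n → Var m n

record Atom (Γ : TemporalLanguage) (m n : ℕ) : Set where
  constructor atom
  field
    sym  : Sym Γ
    args : Fin (arity Γ sym) → Var m n

Matrix : TemporalLanguage → ℕ → ℕ → Set
Matrix Γ m n = List (Atom Γ m n)

val : ∀ {m n} → (Fin m → ℚ) → ℚ → (Fin n → ℚ) → Var m n → ℚ
val z y x (zv i) = z i
val z y x yv     = y
val z y x (xv j) = x j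

holds : ∀ {Γ m n} → Matrix Γ m n → (Fin m → ℚ) → ℚ → (Fin n → ℚ) → Set
holds {Γ} φ z y x =
  All (λ a → rel Γ (Atom.sym a) (λ i → val z y x (Atom.args a i))) φ

Φ : ∀ {Γ m n} → Matrix Γ m n → (Fin m → ℚ) → Set
Φ φ z = ∀ (y : ℚ) → Σ (Fin _ → ℚ) λ x → holds φ z y x

Φ' : ∀ {Γ m n} → Matrix Γ m n → (Fin m → ℚ) → Set
Φ' φ z = Σ ℚ λ y → Σ (Fin _ → ℚ) λ x → holds φ z y x × (∀ i → z i < y)

-- Satisfaction of φ depends only on the order type of the assignment: the relations
-- of Γ are first-order definable over (ℚ; <), and a back-and-forth argument extends
-- any order isomorphism of finite tuples by one point.  Given a solution of Φ' at
-- y₀ > z and any y, order-invariance yields a solution at (z, Y) for Y above y and z,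
-- and translating the witness z₀ of Φ yields one at (z₀ + c, y) with z < z₀ + c.
-- Since h agrees with e ∘ min off the diagonal for a strictly increasing e, applying
-- h to these two solutions gives a solution at (e ∘ z, e y), hence one at (z, y).
module Submission where

open import Defs
open import Data.Nat using (ℕ; zero; suc)
import Data.Nat as ℕ
open import Data.Fin using (Fin; zero; suc; _↑ˡ_; _↑ʳ_)
open import Data.Fin.Properties using (any?)
open import Data.Rational using (ℚ; _<_; _+_; _-_; 0ℚ; 1ℚ; _⊓_; _⊔_)
open import Data.Rational.Properties
open import Data.Product using (Σ; _×_; _,_; proj₁; proj₂)
open import Data.Sum using (inj₁; inj₂)
open import Data.Empty using (⊥-elim)
open import Data.List using ([]; _∷_)
open import Data.List.Relation.Unary.All as All using ([]; _∷_)
open import Data.Vec.Functional using (zipWith)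
open import Function using (_∘_; id)
open import Function.Bundles using (_⇔_; mk⇔; Equivalence)
open import Relation.Nullary using (yes; no)
open import Relation.Binary using (_Preserves_⟶_; tri<; tri≈; tri>)
open import Relation.Binary.PropositionalEquality
  using (_≡_; _≢_; _≗_; refl; sym; trans; cong; subst; subst₂)

private
  variable
    I J : Set
    k : ℕ

p<p+1 : ∀ p → p < p + 1ℚ
p<p+1 p = subst (_< p + 1ℚ) (+-identityʳ p) (+-monoʳ-< p (positive⁻¹ 1ℚ))

p-1<p : ∀ p → p - 1ℚ < p
p-1<p p = subst (p - 1ℚ <_) (+-identityʳ p) (+-monoʳ-< p (neg-antimono-< (positive⁻¹ 1ℚ)))

p-q+q≡p : ∀ p q → p - q + q ≡ p
p-q+q≡p p q = trans (+-assoc p _ q) (trans (cong (p +_) (+-inverseˡ q)) (+-identityʳ p))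

q+[p-q]≡p : ∀ p q → q + (p - q) ≡ p
q+[p-q]≡p p q = trans (+-comm q (p - q)) (p-q+q≡p p q)

⊔-lub-< : ∀ {p q r} → p < r → q < r → p ⊔ q < r
⊔-lub-< {p} {q} p<r q<r with ⊔-sel p q
... | inj₁ p⊔q≡p = subst (_< _) (sym p⊔q≡p) p<r
... | inj₂ p⊔q≡q = subst (_< _) (sym p⊔q≡q) q<r

⊓-glb-< : ∀ {p q r} → r < p → r < q → r < p ⊓ q
⊓-glb-< {p} {q} r<p r<q with ⊓-sel p q
... | inj₁ p⊓q≡p = subst (_ <_) (sym p⊓q≡p) r<p
... | inj₂ p⊓q≡q = subst (_ <_) (sym p⊓q≡q) r<q

strictUpperBound : (f : Fin k → ℚ) → Σ ℚ λ u → ∀ i → f i < u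
strictUpperBound {zero}  f = 0ℚ , λ ()
strictUpperBound {suc k} f with strictUpperBound (f ∘ suc)
... | u , f∘suc<u = (f zero + 1ℚ) ⊔ u , λ
  { zero    → <-≤-trans (p<p+1 (f zero)) (p≤p⊔q (f zero + 1ℚ) u)
  ; (suc i) → <-≤-trans (f∘suc<u i) (p≤q⊔p (f zero + 1ℚ) u) }

strictLowerBound : (f : Fin k → ℚ) → Σ ℚ λ l → ∀ i → l < f i
strictLowerBound {zero}  f = 0ℚ , λ ()
strictLowerBound {suc k} f with strictLowerBound (f ∘ suc)
... | l , l<f∘suc = (f zero - 1ℚ) ⊓ l , λ
  { zero    → ≤-<-trans (p⊓q≤p (f zero - 1ℚ) l) (p-1<p (f zero))
  ; (suc i) → ≤-<-trans (p⊓q≤q (f zero - 1ℚ) l) (l<f∘suc i) }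

infix 4 _≲_ _≅_

_≲_ : (I → ℚ) → (I → ℚ) → Set
t ≲ s = ∀ i j → t i < t j → s i < s j

_≅_ : (I → ℚ) → (I → ℚ) → Set
t ≅ s = t ≲ s × s ≲ t

≅-sym : {t s : I → ℚ} → t ≅ s → s ≅ t
≅-sym (t≲s , s≲t) = s≲t , t≲s

≅-trans : {t s u : I → ℚ} → t ≅ s → s ≅ u → t ≅ u
≅-trans (t≲s , s≲t) (s≲u , u≲s) =
  (λ i j → s≲u i j ∘ t≲s i j) , (λ i j → s≲t i j ∘ u≲s i j)

≅-reflexive : {t s : I → ℚ} → t ≗ s → t ≅ s
≅-reflexive t≗s =
  (λ i j → subst₂ _<_ (t≗s i) (t≗s j)) ,
  (λ i j → subst₂ _<_ (sym (t≗s i)) (sym (t≗s j)))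

≅-∘ : {t s : I → ℚ} → t ≅ s → (g : J → I) → t ∘ g ≅ s ∘ g
≅-∘ (t≲s , s≲t) g = (λ i j → t≲s (g i) (g j)) , (λ i j → s≲t (g i) (g j))

≅-≡ : {t s : I → ℚ} → t ≅ s → ∀ i j → t i ≡ t j → s i ≡ s j
≅-≡ {t = t} {s} (_ , s≲t) i j tᵢ≡tⱼ with <-cmp (s i) (s j)
... | tri< sᵢ<sⱼ _ _ = ⊥-elim (<-irrefl tᵢ≡tⱼ (s≲t i j sᵢ<sⱼ))
... | tri≈ _ sᵢ≡sⱼ _ = sᵢ≡sⱼ
... | tri> _ _ sⱼ<sᵢ = ⊥-elim (<-irrefl (sym tᵢ≡tⱼ) (s≲t j i sⱼ<sᵢ))

≅-mono : ∀ {f} → f Preserves _<_ ⟶ _<_ → (t : I → ℚ) → t ≅ f ∘ t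
≅-mono {f = f} f-mono t = (λ i j → f-mono) , λ i j → reflect
  where
  reflect : ∀ {x y} → f x < f y → x < y
  reflect {x} {y} fx<fy with <-cmp x y
  ... | tri< x<y _ _ = x<y
  ... | tri≈ _ x≡y _ = ⊥-elim (<-irrefl (cong f x≡y) fx<fy)
  ... | tri> _ _ y<x = ⊥-elim (<-asym fx<fy (f-mono y<x))

extend-≅ : {t s : Fin k → ℚ} {a b : ℚ} → t ≅ s →
  (∀ i → t i < a → s i < b) → (∀ i → a < t i → b < s i) → (∀ i → t i ≡ a → s i ≡ b) →
  extend a t ≅ extend b s
extend-≅ {t = t} {s} {a} {b} (t≲s , s≲t) below above equal = forth , back
  where
  below⁻ : ∀ i → s i < b → t i < a
  below⁻ i sᵢ<b with <-cmp (t i) a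
  ... | tri< tᵢ<a _ _ = tᵢ<a
  ... | tri≈ _ tᵢ≡a _ = ⊥-elim (<-irrefl (equal i tᵢ≡a) sᵢ<b)
  ... | tri> _ _ a<tᵢ = ⊥-elim (<-asym sᵢ<b (above i a<tᵢ))

  above⁻ : ∀ i → b < s i → a < t i
  above⁻ i b<sᵢ with <-cmp (t i) a
  ... | tri< tᵢ<a _ _ = ⊥-elim (<-asym b<sᵢ (below i tᵢ<a))
  ... | tri≈ _ tᵢ≡a _ = ⊥-elim (<-irrefl (sym (equal i tᵢ≡a)) b<sᵢ)
  ... | tri> _ _ a<tᵢ = a<tᵢ

  forth : extend a t ≲ extend b s
  forth zero    zero    a<a = ⊥-elim (<-irrefl refl a<a)
  forth zero    (suc j) = above j
  forth (suc i) zero    = below i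
  forth (suc i) (suc j) = t≲s i j

  back : extend b s ≲ extend a t
  back zero    zero    b<b = ⊥-elim (<-irrefl refl b<b)
  back zero    (suc j) = above⁻ j
  back (suc i) zero    = below⁻ i
  back (suc i) (suc j) = s≲t i j

extend-above-≅ : {z : Fin k → ℚ} {u v : ℚ} → (∀ i → z i < u) → (∀ i → z i < v) →
  extend u z ≅ extend v z
extend-above-≅ z<u z<v = extend-≅ (≅-reflexive λ _ → refl)
  (λ i _ → z<v i)
  (λ i u<zᵢ → ⊥-elim (<-asym u<zᵢ (z<u i)))
  (λ i zᵢ≡u → ⊥-elim (<-irrefl zᵢ≡u (z<u i)))

-- b is found by shrinking the interval (l, u) past each sᵢ in turn.
separate : (t s : Fin k → ℚ) (a : ℚ) → t ≲ s → ∀ {l u} → l < u →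
  (∀ i → t i < a → s i < u) → (∀ i → a < t i → l < s i) →
  Σ ℚ λ b → l < b × b < u × (∀ i → t i < a → s i < b) × (∀ i → a < t i → b < s i)
separate {zero} t s a t≲s l<u _ _ with <-dense l<u
... | b , l<b , b<u = b , l<b , b<u , (λ ()) , (λ ())
separate {suc k} t s a t≲s {l} {u} l<u below above with <-cmp (t zero) a
... | tri< t₀<a _ _
  with separate (t ∘ suc) (s ∘ suc) a (λ i j → t≲s (suc i) (suc j))
         (⊔-lub-< l<u (below zero t₀<a)) (below ∘ suc)
         (λ i a<tᵢ → ⊔-lub-< (above (suc i) a<tᵢ) (t≲s zero (suc i) (<-trans t₀<a a<tᵢ)))
...   | b , l⊔s₀<b , b<u , below′ , above′ =
        b , ≤-<-trans (p≤p⊔q l _) l⊔s₀<b , b<u ,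
        (λ { zero _ → ≤-<-trans (p≤q⊔p l _) l⊔s₀<b ; (suc i) → below′ i }) ,
        (λ { zero a<t₀ → ⊥-elim (<-asym t₀<a a<t₀) ; (suc i) → above′ i })
separate {suc k} t s a t≲s {l} {u} l<u below above | tri≈ _ t₀≡a _
  with separate (t ∘ suc) (s ∘ suc) a (λ i j → t≲s (suc i) (suc j)) l<u (below ∘ suc) (above ∘ suc)
...   | b , l<b , b<u , below′ , above′ =
        b , l<b , b<u ,
        (λ { zero t₀<a → ⊥-elim (<-irrefl t₀≡a t₀<a) ; (suc i) → below′ i }) ,
        (λ { zero a<t₀ → ⊥-elim (<-irrefl (sym t₀≡a) a<t₀) ; (suc i) → above′ i })
separate {suc k} t s a t≲s {l} {u} l<u below above | tri> _ _ a<t₀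
  with separate (t ∘ suc) (s ∘ suc) a (λ i j → t≲s (suc i) (suc j))
         (⊓-glb-< l<u (above zero a<t₀))
         (λ i tᵢ<a → ⊓-glb-< (below (suc i) tᵢ<a) (t≲s (suc i) zero (<-trans tᵢ<a a<t₀)))
         (above ∘ suc)
...   | b , l<b , b<u⊓s₀ , below′ , above′ =
        b , l<b , <-≤-trans b<u⊓s₀ (p⊓q≤p u _) ,
        (λ { zero t₀<a → ⊥-elim (<-asym t₀<a a<t₀) ; (suc i) → below′ i }) ,
        (λ { zero _ → <-≤-trans b<u⊓s₀ (p⊓q≤q u _) ; (suc i) → above′ i })

≅-extend : {t s : Fin k → ℚ} → t ≅ s → ∀ a → Σ ℚ λ b → extend a t ≅ extend b s
≅-extend {t = t} {s} t≅s a with any? (λ i → t i ≟ a)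
... | yes (j , tⱼ≡a) = s j , extend-≅ t≅s
  (λ i tᵢ<a → proj₁ t≅s i j (subst (t i <_) (sym tⱼ≡a) tᵢ<a))
  (λ i a<tᵢ → proj₁ t≅s j i (subst (_< t i) (sym tⱼ≡a) a<tᵢ))
  (λ i tᵢ≡a → ≅-≡ t≅s i j (trans tᵢ≡a (sym tⱼ≡a)))
... | no ∄tᵢ≡a
  with strictLowerBound s
...   | l , l<s with strictUpperBound (extend l s)
...   | u , extend-l-s<u
  with separate t s a (proj₁ t≅s) (extend-l-s<u zero) (λ i _ → extend-l-s<u (suc i)) (λ i _ → l<s i)
...   | b , _ , _ , below , above =
        b , extend-≅ t≅s below above (λ i tᵢ≡a → ⊥-elim (∄tᵢ≡a (i , tᵢ≡a)))

prepend : ∀ {n} → (Fin n → ℚ) → (Fin k → ℚ) → Fin (n ℕ.+ k) → ℚ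
prepend {n = zero}  x t = t
prepend {n = suc n} x t = extend (x zero) (prepend (x ∘ suc) t)

prepend-↑ˡ : ∀ {n} (x : Fin n → ℚ) (t : Fin k → ℚ) j → prepend x t (j ↑ˡ k) ≡ x j
prepend-↑ˡ x t zero    = refl
prepend-↑ˡ x t (suc j) = prepend-↑ˡ (x ∘ suc) t j

prepend-↑ʳ : ∀ n (x : Fin n → ℚ) (t : Fin k → ℚ) i → prepend x t (n ↑ʳ i) ≡ t i
prepend-↑ʳ zero    x t i = refl
prepend-↑ʳ (suc n) x t i = prepend-↑ʳ n (x ∘ suc) t i

≅-prepend : {t s : Fin k → ℚ} → t ≅ s → ∀ {n} (x : Fin n → ℚ) →
  Σ (Fin n → ℚ) λ x′ → prepend x t ≅ prepend x′ s
≅-prepend t≅s {zero}  x = x , t≅s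
≅-prepend t≅s {suc n} x with ≅-prepend t≅s (x ∘ suc)
... | x′ , xt≅x′s with ≅-extend xt≅x′s (x zero)
... | b , ext≅ = extend b x′ , ext≅

⟦⟧-≅ : (ψ : FO k) {t s : Fin k → ℚ} → t ≅ s → ⟦ ψ ⟧ t → ⟦ ψ ⟧ s
⟦⟧-≅ ⊤ᶠ        t≅s _         = _
⟦⟧-≅ (ltᶠ i j) t≅s tᵢ<tⱼ     = proj₁ t≅s i j tᵢ<tⱼ
⟦⟧-≅ (eqᶠ i j) t≅s tᵢ≡tⱼ     = ≅-≡ t≅s i j tᵢ≡tⱼ
⟦⟧-≅ (¬ᶠ ψ)    t≅s ¬ψt ψs    = ¬ψt (⟦⟧-≅ ψ (≅-sym t≅s) ψs)
⟦⟧-≅ (ψ ∧ᶠ χ)  t≅s (ψt , χt) = ⟦⟧-≅ ψ t≅s ψt , ⟦⟧-≅ χ t≅s χt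
⟦⟧-≅ (∃ᶠ ψ)    t≅s (a , ψat) with ≅-extend t≅s a
... | b , at≅bs = b , ⟦⟧-≅ ψ at≅bs ψat

rel-≅ : (Γ : TemporalLanguage) (R : Sym Γ) {t s : Fin (arity Γ R) → ℚ} →
  t ≅ s → rel Γ R t → rel Γ R s
rel-≅ Γ R {t} {s} t≅s Rt with definable Γ R
... | ψ , R⇔ψ = Equivalence.from (R⇔ψ s) (⟦⟧-≅ ψ t≅s (Equivalence.to (R⇔ψ t) Rt))

module _ {Γ : TemporalLanguage} {m n : ℕ} (φ : Matrix Γ m n) where

  holds-≅ : ∀ {z y x z′ y′ x′} → val z y x ≅ val z′ y′ x′ → holds φ z y x → holds φ z′ y′ x′
  holds-≅ val≅ = All.map λ {a} → rel-≅ Γ (Atom.sym a) (≅-∘ val≅ (Atom.args a))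

  Solvable : (Fin m → ℚ) → ℚ → Set
  Solvable z y = Σ (Fin n → ℚ) (holds φ z y)

  position : Var m n → Fin (n ℕ.+ suc m)
  position (xv j) = j ↑ˡ suc m
  position yv     = n ↑ʳ zero
  position (zv i) = n ↑ʳ suc i

  val≗prepend : ∀ z y x → val z y x ≗ prepend x (extend y z) ∘ position
  val≗prepend z y x (xv j) = sym (prepend-↑ˡ x (extend y z) j)
  val≗prepend z y x yv     = sym (prepend-↑ʳ n x (extend y z) zero)
  val≗prepend z y x (zv i) = sym (prepend-↑ʳ n x (extend y z) (suc i))

  solvable-≅ : ∀ {z y z′ y′} → extend y z ≅ extend y′ z′ → Solvable z y → Solvable z′ y′
  solvable-≅ {z} {y} {z′} {y′} yz≅y′z′ (x , H) with ≅-prepend yz≅y′z′ x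
  ... | x′ , prepend≅ = x′ , holds-≅ val≅ H
    where
    val≅ : val z y x ≅ val z′ y′ x′
    val≅ = ≅-trans (≅-reflexive (val≗prepend z y x))
             (≅-trans (≅-∘ prepend≅ position) (≅-reflexive (sym ∘ val≗prepend z′ y′ x′)))

  Φ-translate : ∀ {z} → Φ φ z → ∀ c → Φ φ (λ i → c + z i)
  Φ-translate {z} Φz c y = solvable-≅ (≅-trans (≅-mono (+-monoʳ-< c) (extend (y - c) z))
    (≅-reflexive λ { zero → q+[p-q]≡p y c ; (suc i) → refl })) (Φz (y - c))

  val-zipWith : (h : ℚ → ℚ → ℚ) {z z′ : Fin m → ℚ} {y y′ : ℚ} {x x′ : Fin n → ℚ} →
    (λ v → h (val z y x v) (val z′ y′ x′ v)) ≗ val (zipWith h z z′) (h y y′) (zipWith h x x′)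
  val-zipWith h (xv j) = refl
  val-zipWith h yv     = refl
  val-zipWith h (zv i) = refl

  holds-zipWith : ∀ {h} → Preserves h Γ → ∀ {z y x z′ y′ x′} →
    holds φ z y x → holds φ z′ y′ x′ → holds φ (zipWith h z z′) (h y y′) (zipWith h x x′)
  holds-zipWith {h} pres {z} {y} {x} {z′} {y′} {x′} = go φ
    where
    go : (ψ : Matrix Γ m n) → holds ψ z y x → holds ψ z′ y′ x′ →
      holds ψ (zipWith h z z′) (h y y′) (zipWith h x x′)
    go [] _ _ = []
    go (a ∷ ψ) (Ra ∷ Hψ) (Ra′ ∷ Hψ′) =
      rel-≅ Γ (Atom.sym a) (≅-reflexive (val-zipWith h ∘ Atom.args a))
        (pres (Atom.sym a) _ _ Ra Ra′)
      ∷ go ψ Hψ Hψ′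

record OffDiagonalMin (h : ℚ → ℚ → ℚ) : Set where
  field
    embed        : ℚ → ℚ
    embed-mono   : embed Preserves _<_ ⟶ _<_
    off-diagonal : ∀ {x y} → x ≢ y → h x y ≡ embed (x ⊓ y)

  h-<ˡ : ∀ {x y} → x < y → h x y ≡ embed x
  h-<ˡ x<y = trans (off-diagonal (<⇒≢ x<y)) (cong embed (p≤q⇒p⊓q≡p (<⇒≤ x<y)))

  h-<ʳ : ∀ {x y} → y < x → h x y ≡ embed y
  h-<ʳ y<x = trans (off-diagonal (<⇒≢ y<x ∘ sym)) (cong embed (p≥q⇒p⊓q≡q (<⇒≤ y<x)))

mx-off-diagonal : ∀ α β {x y} → x ≢ y → mx α β x y ≡ α (x ⊓ y)
mx-off-diagonal α β {x} {y} x≢y with x ≟ y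
... | yes x≡y = ⊥-elim (x≢y x≡y)
... | no  _   = refl

minOrMx⇒offDiagonalMin : ∀ {h} → IsMinOrMx h → OffDiagonalMin h
minOrMx⇒offDiagonalMin (inj₁ h≡⊓) = record
  { embed = id ; embed-mono = id ; off-diagonal = λ {x} {y} _ → h≡⊓ x y }
minOrMx⇒offDiagonalMin (inj₂ (α , β , (α-mono , _) , h≡mx)) = record
  { embed        = α
  ; embed-mono   = α-mono _ _
  ; off-diagonal = λ {x} {y} x≢y → trans (h≡mx x y) (mx-off-diagonal α β x≢y)
  }

module _ {Γ : TemporalLanguage} {m n : ℕ} (φ : Matrix Γ m n) where

  -- Under h the two solutions meet in an assignment of the order type of (z, y).
  solvable-meet : ∀ {h} → OffDiagonalMin h → Preserves h Γ →
    ∀ {z w y Y} → (∀ i → z i < w i) → y < Y →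
    Solvable φ z Y → Solvable φ w y → Solvable φ z y
  solvable-meet {h} h-min pres {z} {w} {y} {Y} z<w y<Y (x , H) (x′ , H′) =
    solvable-≅ φ (≅-sym (≅-trans (≅-mono embed-mono (extend y z)) (≅-reflexive meet≗)))
      (zipWith h x x′ , holds-zipWith φ pres H H′)
    where
    open OffDiagonalMin h-min
    meet≗ : embed ∘ extend y z ≗ extend (h Y y) (zipWith h z w)
    meet≗ zero    = sym (h-<ʳ y<Y)
    meet≗ (suc i) = sym (h-<ˡ (z<w i))

  Φ⇒Φ′ : ∀ {z} → Φ φ z → Φ' φ z
  Φ⇒Φ′ {z} Φz with strictUpperBound z
  ... | y , z<y = y , proj₁ (Φz y) , proj₂ (Φz y) , z<y

  Φ′⇒Φ : ∀ {h} → OffDiagonalMin h → Preserves h Γ →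
    ∀ {z₀} → Φ φ z₀ → ∀ {z} → Φ' φ z → Φ φ z
  Φ′⇒Φ h-min pres {z₀} Φz₀ {z} (y₀ , x₀ , H₀ , z<y₀) y
    with strictUpperBound (extend y z) | strictUpperBound (λ i → z i - z₀ i)
  ... | Y , yz<Y | c , z-z₀<c =
    solvable-meet h-min pres z<c+z₀ (yz<Y zero)
      (solvable-≅ φ (extend-above-≅ z<y₀ (yz<Y ∘ suc)) (x₀ , H₀))
      (Φ-translate φ Φz₀ c y)
    where
    z<c+z₀ : ∀ i → z i < c + z₀ i
    z<c+z₀ i = subst (_< c + z₀ i) (p-q+q≡p (z i) (z₀ i)) (+-monoˡ-< (z₀ i) (z-z₀<c i))

lemma4p2 : (Γ : TemporalLanguage) (h : ℚ → ℚ → ℚ) →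
    IsMinOrMx h → Preserves h Γ →
    (m n : ℕ) (φ : Matrix Γ m n) →
    Σ (Fin m → ℚ) (λ z → Φ φ z) →
    ∀ (z : Fin m → ℚ) → Φ φ z ⇔ Φ' φ z
lemma4p2 Γ h h∈minOrMx pres m n φ (z₀ , Φz₀) z =
  mk⇔ (Φ⇒Φ′ φ) (Φ′⇒Φ φ (minOrMx⇒offDiagonalMin h∈minOrMx) pres Φz₀)
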